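{- Let $I=(\frac{p_1}{q_1},\frac{p_2}{q_2})$ be a finite Farey interval which contains a $4$-aloof number. Then $\frac15\le \frac{q_1}{q_2}\le 5$.
   Context: A Farey interval is an open interval $(\frac{p_1}{q_1},\frac{p_2}{q_2})\subset(0,\infty)$ whose endpoints are given by nonnegative integers $p_1,q_1,p_2,q_2$ with $p_2q_1-p_1q_2=1$, where $\frac01=0$ and $\frac10=\infty$ are allowed. Equivalently, Farey intervals form a binary tree with root $(\frac01,\frac10)$, in which each Farey interval $J=(\frac{p_1}{q_1},\frac{p_2}{q_2})$ has children $L(J)=(\frac{p_1}{q_1},\frac{p_1+p_2}{q_1+q_2})$ and $R(J)=(\frac{p_1+p_2}{q_1+q_2},\frac{p_2}{q_2})$. A Farey interval is finite if $q_2>0$. A real number $x>0$ is $n$-aloof ($n$ a positive integer) if $x$ is irrational and all terms of its continued fraction expansion $x=[a_0;a_1,a_2,\ldots]$ (with $a_0\ge0$, $a_i\ge1$ for $i\ge1$ integers) satisfy $a_i\le n$ for all $i\ge0$. -}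

module Defs where

open import Data.Nat using (ℕ; zero; suc; _+_; _*_; _≤_; _<_)
open import Data.Product using (_×_; _,_; proj₁; proj₂; ∃-syntax)

-- A positive real number x with continued fraction expansion
-- x = [a 0; a 1, a 2, ...] is represented by the sequence a : ℕ → ℕ
-- (a 0 ≥ 0, a i ≥ 1 for i ≥ 1).  An infinite expansion is exactly an
-- irrational number.

CF : Set
CF = ℕ → ℕ

IsCF : CF → Set
IsCF a = ∀ i → 1 ≤ a (suc i)

Aloof : ℕ → CF → Set
Aloof n a = IsCF a × (∀ i → a i ≤ n)

-- convergents: hk a n = ((h_{n-1}, k_{n-1}) , (h_n , k_n)),
-- with h_{-1} = 1, k_{-1} = 0, h_0 = a_0, k_0 = 1,
-- h_n = a_n h_{n-1} + h_{n-2}, k_n = a_n k_{n-1} + k_{n-2}.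
hk : CF → ℕ → (ℕ × ℕ) × (ℕ × ℕ)
hk a zero = (1 , 0) , (a 0 , 1)
hk a (suc n) with hk a n
... | (h' , k') , (h , k) = (h , k) , (a (suc n) * h + h' , a (suc n) * k + k')

num : CF → ℕ → ℕ
num a n = proj₁ (proj₂ (hk a n))

den : CF → ℕ → ℕ
den a n = proj₂ (proj₂ (hk a n))

-- Order between the real x = [a] and a rational p/q (q > 0), defined via
-- the convergents: x is the supremum of its even convergents and the
-- infimum of its odd convergents.
-- p/q < x
RatBelow : ℕ → ℕ → CF → Set
RatBelow p q a = ∃[ n ] (p * den a (2 * n) < num a (2 * n) * q)

RatAbove : CF → ℕ → ℕ → Set
RatAbove a p q = ∃[ n ] (num a (suc (2 * n)) * q < p * den a (suc (2 * n)))

IsFarey : ℕ → ℕ → ℕ → ℕ → Set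
IsFarey p₁ q₁ p₂ q₂ = p₂ * q₁ ≡ p₁ * q₂ + 1
  where open import Relation.Binary.PropositionalEquality using (_≡_)

IsFiniteFarey : ℕ → ℕ → ℕ → ℕ → Set
IsFiniteFarey p₁ q₁ p₂ q₂ = IsFarey p₁ q₁ p₂ q₂ × (0 < q₂)

InInterval : CF → ℕ → ℕ → ℕ → ℕ → Set
InInterval a p₁ q₁ p₂ q₂ = RatBelow p₁ q₁ a × RatAbove a p₂ q₂

-- Write (h_{i-2}, k_{i-2}) = α_i (p₁, q₁) + β_i (p₂, q₂). As p₂q₁ − p₁q₂ = 1, the coordinates are
-- integers, they satisfy the recurrence of the convergents, and consecutive coordinate vectors have
-- determinant ±1. Interlacing of even and odd convergents turns x ∈ I into α_i > 0 for even i and β_i > 0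
-- for odd i, so the vectors enter the open positive quadrant. Where they first do so, the determinant forces
-- the two previous vectors to be one basis vector e and the other basis vector minus D e, with 0 ≤ D < a_i.
-- Hence {q₁, q₂} = {k_{i-1}, k_{i-2} + D k_{i-1}}, and for 1 ≤ a_j ≤ n the ratio of these two lies between
-- 1/(n+1) and n+1.

module Submission where

open import Defs
open import Data.Nat using (ℕ; zero; suc; z≤n; s≤s)
import Data.Nat as ℕ
import Data.Nat.Properties as ℕ
open import Data.Product using (_×_; _,_; proj₁; proj₂; ∃-syntax; swap)
open import Data.Sum using (_⊎_; inj₁; inj₂; [_,_]′)
open import Function using (_∘_)
open import Relation.Nullary using (¬_; contradiction)
open import Relation.Nullary.Decidable using (_×-dec_; toSum)
open import Relation.Binary.PropositionalEquality

data Parity : ℕ → Set where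
  even : ∀ m → Parity (m ℕ.* 2)
  odd  : ∀ m → Parity (suc (m ℕ.* 2))

parity : ∀ n → Parity n
parity zero = even 0
parity (suc n) with parity n
... | even m = odd m
... | odd m  = even (suc m)

farey⇒0<q₁ : ∀ p₁ q₁ p₂ q₂ → IsFarey p₁ q₁ p₂ q₂ → 0 ℕ.< q₁
farey⇒0<q₁ _  (suc _) _  _  _     = s≤s z≤n
farey⇒0<q₁ p₁ zero    p₂ q₂ farey =
  contradiction (trans (sym farey) (ℕ.*-zeroʳ p₂)) (ℕ.m+1+n≢0 (p₁ ℕ.* q₂))

module Convergents (a : CF) where
  open import Data.Nat using (_+_; _*_; _<_)

  -- h i = h_{i-2} and k i = k_{i-2}: the seeds h_{-2}/k_{-2} = 0/1 and h_{-1}/k_{-1} = 1/0 sit at indices 0 and 1.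
  h k : ℕ → ℕ
  h 0 = 0
  h 1 = 1
  h (suc (suc n)) = a n * h (suc n) + h n
  k 0 = 1
  k 1 = 0
  k (suc (suc n)) = a n * k (suc n) + k n

  hk≡ : ∀ n → hk a n ≡ ((h (suc n) , k (suc n)) , (h (suc (suc n)) , k (suc (suc n))))
  hk≡ zero rewrite ℕ.*-identityʳ (a 0) | ℕ.+-identityʳ (a 0) | ℕ.*-zeroʳ (a 0) = refl
  hk≡ (suc n) rewrite hk≡ n = refl

  num-even : ∀ n → num a (2 * n) ≡ h (suc n * 2)
  num-even n = trans (cong (proj₁ ∘ proj₂) (hk≡ (2 * n))) (cong (h ∘ suc ∘ suc) (ℕ.*-comm 2 n))

  den-even : ∀ n → den a (2 * n) ≡ k (suc n * 2)
  den-even n = trans (cong (proj₂ ∘ proj₂) (hk≡ (2 * n))) (cong (k ∘ suc ∘ suc) (ℕ.*-comm 2 n))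

  num-odd : ∀ n → num a (suc (2 * n)) ≡ h (suc (suc n * 2))
  num-odd n = trans (cong (proj₁ ∘ proj₂) (hk≡ (suc (2 * n)))) (cong (h ∘ suc ∘ suc ∘ suc) (ℕ.*-comm 2 n))

  den-odd : ∀ n → den a (suc (2 * n)) ≡ k (suc (suc n * 2))
  den-odd n = trans (cong (proj₂ ∘ proj₂) (hk≡ (suc (2 * n)))) (cong (k ∘ suc ∘ suc ∘ suc) (ℕ.*-comm 2 n))

  -- q = k_{i-1} is the denominator of a convergent and q′ = k_{i-2} + D k_{i-1}, D < a_i, that of an
  -- intermediate fraction next to it.
  IntermediatePair : ℕ → ℕ → Set
  IntermediatePair q q′ = ∃[ i ] ∃[ D ] (D < a i × q ≡ k (suc i) × q′ ≡ k i + D * k (suc i))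

open Convergents

module IntegerSigns where
  open import Data.Integer
    using (ℤ; +_; +[1+_]; 0ℤ; 1ℤ; -1ℤ; _+_; _-_; _*_; -_; _≤_; _<_; +≤+; -≤+; +<+; nonNegative)
  open import Data.Integer.Properties

  i<j⇒0<j-i : ∀ {i j} → i < j → 0ℤ < j - i
  i<j⇒0<j-i {i} {j} i<j = subst (_< j - i) (+-inverseʳ i) (+-monoˡ-< (- i) i<j)

  0<j-i⇒i<j : ∀ {i j} → 0ℤ < j - i → i < j
  0<j-i⇒i<j {i} {j} 0<j-i = subst₂ _<_ (+-identityˡ i) j-i+i≡j (+-monoˡ-< i 0<j-i)
    where
    j-i+i≡j : j - i + i ≡ j
    j-i+i≡j = trans (+-assoc j (- i) i) (trans (cong (_+_ j) (+-inverseˡ i)) (+-identityʳ j))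

  pos-diff : ∀ m n m′ n′ → m ℕ.* n ℕ.< m′ ℕ.* n′ → 0ℤ < + m′ * + n′ - + m * + n
  pos-diff m n m′ n′ lt = subst₂ (λ u v → 0ℤ < u - v) (pos-* m′ n′) (pos-* m n) (i<j⇒0<j-i (+<+ lt))

  0≤i*j : ∀ {i j} → 0ℤ ≤ i → 0ℤ ≤ j → 0ℤ ≤ i * j
  0≤i*j {i} 0≤i 0≤j = subst (_≤ i * _) (*-zeroʳ i) (*-monoˡ-≤-nonNeg i {{nonNegative 0≤i}} 0≤j)

  positive-factor : ∀ {u v c} → 0ℤ ≤ v → 0ℤ ≤ c → 0ℤ < u * v - c → 0ℤ < u
  positive-factor {v = v} 0≤v 0≤c 0<uv-c =
    *-cancelʳ-<-nonNeg v {{nonNegative 0≤v}} (≤-<-trans 0≤c (0<j-i⇒i<j 0<uv-c))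

  0≮-n : ∀ n → ¬ 0ℤ < - + n
  0≮-n n = ≤⇒≯ (neg-mono-≤ (+≤+ z≤n))

  nonpos⇒neg : ∀ {i} → i ≤ 0ℤ → ∃[ n ] i ≡ - + n
  nonpos⇒neg (-≤+ {m}) = suc m , refl
  nonpos⇒neg (+≤+ z≤n) = 0 , refl

  -- For w₁ < 0 both w₁ v₂ and - w₂ v₁ are at most -1, which makes the first clause absurd.
  unimodular-quadrant : ∀ {w₁ w₂ v₁ v₂} → w₁ ≤ 0ℤ → 0ℤ < w₂ → 0ℤ < v₁ → 0ℤ < v₂ →
                        w₁ * v₂ - w₂ * v₁ ≡ -1ℤ → w₁ ≡ 0ℤ × w₂ ≡ 1ℤ × v₁ ≡ 1ℤ
  unimodular-quadrant -≤+ (+<+ (s≤s z≤n)) (+<+ (s≤s z≤n)) (+<+ (s≤s z≤n)) ()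
  unimodular-quadrant {w₂ = +[1+ m ]} {v₁ = +[1+ n ]} (+≤+ z≤n) (+<+ (s≤s z≤n)) (+<+ (s≤s z≤n)) _ det≡-1 =
    refl , cong +_ (ℕ.m*n≡1⇒m≡1 (suc m) (suc n) mn≡1) , cong +_ (ℕ.m*n≡1⇒n≡1 (suc m) (suc n) mn≡1)
    where
    mn≡1 : suc m ℕ.* suc n ≡ 1
    mn≡1 = cong suc (-[1+-injective det≡-1)

module Recurrence (a : CF) where
  open import Data.Integer using (ℤ; +_; 0ℤ; 1ℤ; -1ℤ; _+_; _-_; _*_; -_; _≤_; _<_; +≤+; +<+)
  open import Data.Integer.Properties
  open import Data.Integer.Tactic.RingSolver using (solve-∀)
  open IntegerSigns
  open ≡-Reasoning

  Solves : (ℕ → ℤ) → Set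
  Solves x = ∀ n → x (suc (suc n)) ≡ + a n * x (suc n) + x n

  +-solves : ∀ {f : ℕ → ℕ} → (∀ n → f (suc (suc n)) ≡ a n ℕ.* f (suc n) ℕ.+ f n) → Solves (+_ ∘ f)
  +-solves {f} f-rec n = begin
    + f (suc (suc n))              ≡⟨ cong +_ (f-rec n) ⟩
    + (a n ℕ.* f (suc n) ℕ.+ f n)  ≡⟨ pos-+ (a n ℕ.* f (suc n)) (f n) ⟩
    + (a n ℕ.* f (suc n)) + + f n  ≡⟨ cong (_+ + f n) (pos-* (a n) (f (suc n))) ⟩
    + a n * + f (suc n) + + f n    ∎

  solves-combination : ∀ {x y} → Solves x → Solves y → ∀ s t → Solves (λ i → s * x i - t * y i)
  solves-combination {x} {y} x-solves y-solves s t n = begin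
    s * x (suc (suc n)) - t * y (suc (suc n))
      ≡⟨ cong₂ (λ u v → s * u - t * v) (x-solves n) (y-solves n) ⟩
    s * (c * x (suc n) + x n) - t * (c * y (suc n) + y n)
      ≡⟨ distribute s t c (x (suc n)) (x n) (y (suc n)) (y n) ⟩
    c * (s * x (suc n) - t * y (suc n)) + (s * x n - t * y n) ∎
    where
    c : ℤ
    c = + a n
    distribute : ∀ s t c u v u′ v′ →
                 s * (c * u + v) - t * (c * u′ + v′) ≡ c * (s * u - t * u′) + (s * v - t * v′)
    distribute = solve-∀

  det : (ℕ → ℤ) → (ℕ → ℤ) → ℕ → ℕ → ℤ
  det x y l r = x l * y r - y l * x r

  det-diag : ∀ x y l → det x y l l ≡ 0ℤ
  det-diag x y l = trans (cong (_- y l * x l) (*-comm (x l) (y l))) (+-inverseʳ (y l * x l))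

  det-swap : ∀ x y l r → det y x r l ≡ det x y l r
  det-swap x y l r = cong₂ _-_ (*-comm (y r) (x l)) (*-comm (x r) (y l))

  det-antisym : ∀ x y l r → det y x l r ≡ - det x y l r
  det-antisym x y l r = antisym (x l) (y l) (x r) (y r)
    where
    antisym : ∀ u v u′ v′ → v * u′ - u * v′ ≡ - (u * v′ - v * u′)
    antisym = solve-∀

  det-solves : ∀ {x y} → Solves x → Solves y → ∀ l → Solves (det x y l)
  det-solves {x} {y} x-solves y-solves l = solves-combination y-solves x-solves (x l) (y l)

  det-alternates : ∀ {x y} → Solves x → Solves y → ∀ n → det x y (suc n) (suc (suc n)) ≡ - det x y n (suc n)
  det-alternates {x} {y} x-solves y-solves n = begin
    x (suc n) * y (suc (suc n)) - y (suc n) * x (suc (suc n))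
      ≡⟨ cong₂ (λ u v → x (suc n) * u - y (suc n) * v) (y-solves n) (x-solves n) ⟩
    x (suc n) * (c * y (suc n) + y n) - y (suc n) * (c * x (suc n) + x n)
      ≡⟨ cancel c (x n) (y n) (x (suc n)) (y (suc n)) ⟩
    - (x n * y (suc n) - y n * x (suc n)) ∎
    where
    c : ℤ
    c = + a n
    cancel : ∀ c u v u′ v′ → u′ * (c * v′ + v) - v′ * (c * u′ + u) ≡ - (u * v′ - v * u′)
    cancel = solve-∀

  det-at-even : ∀ {x y} → Solves x → Solves y → ∀ m → det x y (m ℕ.* 2) (suc (m ℕ.* 2)) ≡ det x y 0 1
  det-at-even x-solves y-solves zero = refl
  det-at-even {x} {y} x-solves y-solves (suc m) = begin
    det x y (suc (suc i)) (suc (suc (suc i))) ≡⟨ det-alternates x-solves y-solves (suc i) ⟩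
    - det x y (suc i) (suc (suc i))           ≡⟨ cong -_ (det-alternates x-solves y-solves i) ⟩
    - - det x y i (suc i)                     ≡⟨ neg-involutive _ ⟩
    det x y i (suc i)                         ≡⟨ det-at-even x-solves y-solves m ⟩
    det x y 0 1                               ∎
    where
    i : ℕ
    i = m ℕ.* 2

  det-at-odd : ∀ {x y} → Solves x → Solves y →
               ∀ m → det x y (suc (m ℕ.* 2)) (suc (suc (m ℕ.* 2))) ≡ - det x y 0 1
  det-at-odd x-solves y-solves m =
    trans (det-alternates x-solves y-solves (m ℕ.* 2)) (cong -_ (det-at-even x-solves y-solves m))

  nonneg-pos-persists : ∀ {z n} → Solves z → 0ℤ ≤ z n → 0ℤ < z (suc n) →
                        ∀ t → 0ℤ ≤ z (t ℕ.* 2 ℕ.+ n) × 0ℤ < z (suc (t ℕ.* 2 ℕ.+ n))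
  nonneg-pos-persists z-solves 0≤z 0<z′ zero = 0≤z , 0<z′
  nonneg-pos-persists {z} {n} z-solves 0≤z 0<z′ (suc t) with nonneg-pos-persists z-solves 0≤z 0<z′ t
  ... | 0≤u , 0<v = 0≤w , subst (0ℤ <_) (sym (z-solves (suc i))) (+-mono-≤-< (0≤i*j (0≤a (suc i)) 0≤w) 0<v)
    where
    i : ℕ
    i = t ℕ.* 2 ℕ.+ n
    0≤a : ∀ j → 0ℤ ≤ + a j
    0≤a j = +≤+ z≤n
    0≤w : 0ℤ ≤ z (suc (suc i))
    0≤w = subst (0ℤ ≤_) (sym (z-solves i)) (+-mono-≤ (0≤i*j (0≤a i) (<⇒≤ 0<v)) 0≤u)

  det-positive-ahead : ∀ {x y} → Solves x → Solves y → ∀ l → 0ℤ < det x y l (suc l) →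
                       ∀ t → 0ℤ < det x y l (suc (t ℕ.* 2 ℕ.+ l))
  det-positive-ahead {x} {y} x-solves y-solves l 0<det t =
    proj₂ (nonneg-pos-persists (det-solves x-solves y-solves l) (≤-reflexive (sym (det-diag x y l))) 0<det t)

  -- For (x, y) = (h, k) this says that even convergents lie below odd ones.
  det-interlacing : ∀ {x y} → Solves x → Solves y → 0ℤ < det x y 0 1 →
                    ∀ m n → 0ℤ < det x y (m ℕ.* 2) (suc (n ℕ.* 2))
  det-interlacing {x} {y} x-solves y-solves 0<det m n with ℕ.≤-<-connex m n
  ... | inj₁ m≤n = subst (λ j → 0ℤ < det x y l (suc j)) even-gap
                     (det-positive-ahead x-solves y-solves l 0<det-at-l (n ℕ.∸ m))
    where
    l : ℕ
    l = m ℕ.* 2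
    0<det-at-l : 0ℤ < det x y l (suc l)
    0<det-at-l = subst (0ℤ <_) (sym (det-at-even x-solves y-solves m)) 0<det
    even-gap : (n ℕ.∸ m) ℕ.* 2 ℕ.+ l ≡ n ℕ.* 2
    even-gap = trans (sym (ℕ.*-distribʳ-+ 2 (n ℕ.∸ m) m)) (cong (ℕ._* 2) (ℕ.m∸n+n≡m m≤n))
  ... | inj₂ n<m = subst (0ℤ <_) (det-swap x y l r) (subst (λ j → 0ℤ < det y x r j) odd-gap
                     (det-positive-ahead y-solves x-solves r 0<det-at-r (m ℕ.∸ suc n)))
    where
    l r : ℕ
    l = m ℕ.* 2
    r = suc (n ℕ.* 2)
    0<det-at-r : 0ℤ < det y x r (suc r)
    0<det-at-r = subst (0ℤ <_) (sym (trans (det-at-odd y-solves x-solves n)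
                   (trans (cong -_ (det-antisym x y 0 1)) (neg-involutive _)))) 0<det
    odd-gap : suc ((m ℕ.∸ suc n) ℕ.* 2 ℕ.+ r) ≡ l
    odd-gap = trans (sym (ℕ.+-suc _ r))
                (trans (sym (ℕ.*-distribʳ-+ 2 (m ℕ.∸ suc n) (suc n))) (cong (ℕ._* 2) (ℕ.m∸n+n≡m n<m)))

  InQuadrant : (ℕ → ℤ) → (ℕ → ℤ) → ℕ → Set
  InQuadrant x y i = 0ℤ < x i × 0ℤ < y i

  quadrant-entry : ∀ {x y} → Solves x → Solves y → ∀ i → ¬ InQuadrant x y i →
                   x (suc i) ≤ 0ℤ → 0ℤ < y (suc i) → InQuadrant x y (suc (suc i)) →
                   det x y (suc i) (suc (suc i)) ≡ -1ℤ →
                   x (suc i) ≡ 0ℤ × y (suc i) ≡ 1ℤ × x i ≡ 1ℤ × ∃[ D ] (D ℕ.< a i × y i ≡ - + D)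
  quadrant-entry {x} {y} x-solves y-solves i outside x′≤0 0<y′ (0<x″ , 0<y″) det≡-1
    with unimodular-quadrant x′≤0 0<y′ 0<x″ 0<y″ det≡-1
  ... | x′≡0 , y′≡1 , x″≡1 = x′≡0 , y′≡1 , x≡1 , D , D<a , y≡-D
    where
    x≡1 : x i ≡ 1ℤ
    x≡1 = begin
      x i                      ≡⟨ sym (+-identityˡ (x i)) ⟩
      0ℤ + x i                 ≡⟨ cong (_+ x i) (sym (*-zeroʳ (+ a i))) ⟩
      + a i * 0ℤ + x i         ≡⟨ cong (λ u → + a i * u + x i) (sym x′≡0) ⟩
      + a i * x (suc i) + x i  ≡⟨ sym (x-solves i) ⟩
      x (suc (suc i))          ≡⟨ x″≡1 ⟩
      1ℤ                       ∎
    y≤0 : y i ≤ 0ℤ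
    y≤0 = ≮⇒≥ (λ 0<y → outside (subst (0ℤ <_) (sym x≡1) (+<+ (s≤s z≤n)) , 0<y))
    D : ℕ
    D = proj₁ (nonpos⇒neg y≤0)
    y≡-D : y i ≡ - + D
    y≡-D = proj₂ (nonpos⇒neg y≤0)
    y″≡a-D : y (suc (suc i)) ≡ + a i - + D
    y″≡a-D = begin
      y (suc (suc i))          ≡⟨ y-solves i ⟩
      + a i * y (suc i) + y i  ≡⟨ cong₂ (λ u v → + a i * u + v) y′≡1 y≡-D ⟩
      + a i * 1ℤ - + D         ≡⟨ cong (_- + D) (*-identityʳ (+ a i)) ⟩
      + a i - + D              ∎
    D<a : D ℕ.< a i
    D<a = drop‿+<+ (0<j-i⇒i<j (subst (0ℤ <_) y″≡a-D 0<y″))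

module Coordinates (a : CF) where
  open import Data.Integer using (ℤ; +_; 0ℤ; 1ℤ; -1ℤ; _+_; _-_; _*_; -_; _≤_; _<_; +≤+; +<+)
  open import Data.Integer.Properties
  open import Data.Integer.Tactic.RingSolver using (solve-∀)
  open IntegerSigns
  open Recurrence a
  open ≡-Reasoning

  H K : ℕ → ℤ
  H = +_ ∘ h a
  K = +_ ∘ k a

  H-solves : Solves H
  H-solves = +-solves (λ _ → refl)

  K-solves : Solves K
  K-solves = +-solves (λ _ → refl)

  0≤K : ∀ i → 0ℤ ≤ K i
  0≤K i = +≤+ z≤n

  quadrant-entry⇒intermediate-pair :
    ∀ {x y : ℕ → ℤ} {r s : ℕ} → Solves x → Solves y → (∀ i → K i ≡ + r * x i + + s * y i) →
    ∀ i → ¬ InQuadrant x y i → x (suc i) ≤ 0ℤ → 0ℤ < y (suc i) → InQuadrant x y (suc (suc i)) →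
    det x y (suc i) (suc (suc i)) ≡ -1ℤ → IntermediatePair a s r
  quadrant-entry⇒intermediate-pair {x} {y} {r} {s} x-solves y-solves K≡ i outside x′≤0 0<y′ inside det≡-1
    with quadrant-entry x-solves y-solves i outside x′≤0 0<y′ inside det≡-1
  ... | x′≡0 , y′≡1 , x≡1 , D , D<a , y≡-D = i , D , D<a , s≡k′ , r≡k+Dk′
    where
    unit : ∀ r s → s ≡ r * 0ℤ + s * 1ℤ
    unit = solve-∀
    shift : ∀ r s d → r ≡ r * 1ℤ + s * - d + d * s
    shift = solve-∀
    s≡k′ : s ≡ k a (suc i)
    s≡k′ = +-injective (begin
      + s                                ≡⟨ unit (+ r) (+ s) ⟩
      + r * 0ℤ + + s * 1ℤ                ≡⟨ cong₂ (λ u v → + r * u + + s * v) (sym x′≡0) (sym y′≡1) ⟩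
      + r * x (suc i) + + s * y (suc i)  ≡⟨ sym (K≡ (suc i)) ⟩
      K (suc i)                          ∎)
    r≡k+Dk′ : r ≡ k a i ℕ.+ D ℕ.* k a (suc i)
    r≡k+Dk′ = +-injective (begin
      + r                                 ≡⟨ shift (+ r) (+ s) (+ D) ⟩
      + r * 1ℤ + + s * - + D + + D * + s
        ≡⟨ cong₂ (λ u v → + r * u + + s * v + + D * + s) (sym x≡1) (sym y≡-D) ⟩
      + r * x i + + s * y i + + D * + s   ≡⟨ cong₂ (λ u v → u + + D * + v) (sym (K≡ i)) s≡k′ ⟩
      K i + + D * K (suc i)               ≡⟨ cong (_+_ (K i)) (sym (pos-* D (k a (suc i)))) ⟩
      K i + + (D ℕ.* k a (suc i))         ≡⟨ sym (pos-+ (k a i) (D ℕ.* k a (suc i))) ⟩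
      + (k a i ℕ.+ D ℕ.* k a (suc i))     ∎)

  module FareyCoordinates {p₁ q₁ p₂ q₂ : ℕ} (farey : IsFarey p₁ q₁ p₂ q₂) where

    -- (H i , K i) = α i (p₁ , q₁) + β i (p₂ , q₂)
    α β : ℕ → ℤ
    α i = + p₂ * K i - + q₂ * H i
    β i = + q₁ * H i - + p₁ * K i

    α-solves : Solves α
    α-solves = solves-combination K-solves H-solves (+ p₂) (+ q₂)

    β-solves : Solves β
    β-solves = solves-combination H-solves K-solves (+ q₁) (+ p₁)

    farey-det : + p₂ * + q₁ - + p₁ * + q₂ ≡ 1ℤ
    farey-det = begin
      + p₂ * + q₁ - + p₁ * + q₂            ≡⟨ cong₂ _-_ (sym (pos-* p₂ q₁)) (sym (pos-* p₁ q₂)) ⟩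
      + (p₂ ℕ.* q₁) - + (p₁ ℕ.* q₂)        ≡⟨ cong (λ n → + n - + (p₁ ℕ.* q₂)) farey ⟩
      + (p₁ ℕ.* q₂ ℕ.+ 1) - + (p₁ ℕ.* q₂)  ≡⟨ cong (_- + (p₁ ℕ.* q₂)) (pos-+ (p₁ ℕ.* q₂) 1) ⟩
      + (p₁ ℕ.* q₂) + 1ℤ - + (p₁ ℕ.* q₂)   ≡⟨ cancel (+ (p₁ ℕ.* q₂)) ⟩
      1ℤ                                   ∎
      where
      cancel : ∀ u → u + 1ℤ - u ≡ 1ℤ
      cancel = solve-∀

    K-coordinates : ∀ i → K i ≡ + q₁ * α i + + q₂ * β i
    K-coordinates i = sym (begin
      + q₁ * α i + + q₂ * β i            ≡⟨ collect (+ p₁) (+ q₁) (+ p₂) (+ q₂) (H i) (K i) ⟩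
      (+ p₂ * + q₁ - + p₁ * + q₂) * K i  ≡⟨ cong (_* K i) farey-det ⟩
      1ℤ * K i                           ≡⟨ *-identityˡ (K i) ⟩
      K i                                ∎)
      where
      collect : ∀ p₁ q₁ p₂ q₂ h k →
                q₁ * (p₂ * k - q₂ * h) + q₂ * (q₁ * h - p₁ * k) ≡ (p₂ * q₁ - p₁ * q₂) * k
      collect = solve-∀

    seed : ∀ u v → u * + 0 - v * + 1 ≡ - v
    seed = solve-∀

    0≮β₀ : ¬ 0ℤ < β 0
    0≮β₀ = 0≮-n p₁ ∘ subst (0ℤ <_) (seed (+ q₁) (+ p₁))

    0≮α₁ : ¬ 0ℤ < α 1
    0≮α₁ = 0≮-n q₂ ∘ subst (0ℤ <_) (seed (+ p₂) (+ q₂))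

    det-αK : det α K 0 1 ≡ + q₂
    det-αK = initial (+ p₂) (+ q₂)
      where
      initial : ∀ p q → (p * + 1 - q * + 0) * + 0 - + 1 * (p * + 0 - q * + 1) ≡ q
      initial = solve-∀

    det-Kβ : det K β 0 1 ≡ + q₁
    det-Kβ = initial (+ q₁) (+ p₁)
      where
      initial : ∀ q p → + 1 * (q * + 1 - p * + 0) - (q * + 0 - p * + 1) * + 0 ≡ q
      initial = solve-∀

    det-αβ : det α β 0 1 ≡ 1ℤ
    det-αβ = trans (initial (+ p₁) (+ q₁) (+ p₂) (+ q₂)) farey-det
      where
      initial : ∀ p₁ q₁ p₂ q₂ →
                (p₂ * + 1 - q₂ * + 0) * (q₁ * + 1 - p₁ * + 0) - (q₁ * + 0 - p₁ * + 1) * (p₂ * + 0 - q₂ * + 1)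
                ≡ p₂ * q₁ - p₁ * q₂
      initial = solve-∀

    det-βα : det β α 0 1 ≡ -1ℤ
    det-βα = trans (det-antisym α β 0 1) (cong -_ det-αβ)

    α-even-pos : 0 ℕ.< q₂ → ∀ n → 0ℤ < α (suc (n ℕ.* 2)) → ∀ m → 0ℤ < α (m ℕ.* 2)
    α-even-pos 0<q₂ n 0<α m = positive-factor (0≤K (suc (n ℕ.* 2))) (0≤i*j (0≤K (m ℕ.* 2)) (<⇒≤ 0<α))
      (det-interlacing α-solves K-solves (subst (0ℤ <_) (sym det-αK) (+<+ 0<q₂)) m n)

    β-odd-pos : ∀ m → 0ℤ < β (m ℕ.* 2) → ∀ n → 0ℤ < β (suc (n ℕ.* 2))
    β-odd-pos m 0<β n = positive-factor (0≤K l) (0≤i*j (<⇒≤ 0<β) (0≤K r))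
      (subst (0ℤ <_) reorder (det-interlacing K-solves β-solves (subst (0ℤ <_) (sym det-Kβ) 0<q₁) m n))
      where
      0<q₁ : 0ℤ < + q₁
      0<q₁ = +<+ (farey⇒0<q₁ p₁ q₁ p₂ q₂ farey)
      l r : ℕ
      l = m ℕ.* 2
      r = suc (n ℕ.* 2)
      reorder : det K β l r ≡ β r * K l - β l * K r
      reorder = cong (_- β l * K r) (*-comm (K l) (β r))

    below⇒β-pos : RatBelow p₁ q₁ a → ∃[ m ] 0ℤ < β (m ℕ.* 2)
    below⇒β-pos (n , lt) = suc n , pos-diff p₁ (k a i) q₁ (h a i) lt′
      where
      i : ℕ
      i = suc n ℕ.* 2
      lt′ : p₁ ℕ.* k a i ℕ.< q₁ ℕ.* h a i
      lt′ = subst₂ (λ u v → p₁ ℕ.* u ℕ.< v) (den-even a n) (trans (ℕ.*-comm _ q₁) (cong (q₁ ℕ.*_) (num-even a n))) lt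

    above⇒α-pos : RatAbove a p₂ q₂ → ∃[ n ] 0ℤ < α (suc (n ℕ.* 2))
    above⇒α-pos (n , lt) = suc n , pos-diff q₂ (h a i) p₂ (k a i) lt′
      where
      i : ℕ
      i = suc (suc n ℕ.* 2)
      lt′ : q₂ ℕ.* h a i ℕ.< p₂ ℕ.* k a i
      lt′ = subst₂ (λ u v → u ℕ.< p₂ ℕ.* v) (trans (ℕ.*-comm _ q₂) (cong (q₂ ℕ.*_) (num-odd a n))) (den-odd a n) lt

    inside? : ∀ j → InQuadrant α β j ⊎ ¬ InQuadrant α β j
    inside? j = toSum ((0ℤ <? α j) ×-dec (0ℤ <? β j))

    module _ (α-even : ∀ m → 0ℤ < α (m ℕ.* 2)) (β-odd : ∀ m → 0ℤ < β (suc (m ℕ.* 2))) where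

      entry⇒intermediate-pair : ∀ i → ¬ InQuadrant α β i → ¬ InQuadrant α β (suc i) →
                                InQuadrant α β (suc (suc i)) →
                                IntermediatePair a q₂ q₁ ⊎ IntermediatePair a q₁ q₂
      entry⇒intermediate-pair i outside₀ outside₁ inside with parity i
      ... | even m = inj₁ (quadrant-entry⇒intermediate-pair α-solves β-solves K-coordinates i outside₀
                             α′≤0 (β-odd m) inside (trans (det-at-odd α-solves β-solves m) (cong -_ det-αβ)))
        where
        α′≤0 : α (suc i) ≤ 0ℤ
        α′≤0 = ≮⇒≥ (λ 0<α → outside₁ (0<α , β-odd m))
      ... | odd m  = inj₂ (quadrant-entry⇒intermediate-pair β-solves α-solves K-coordinates′ i (outside₀ ∘ swap)
                             β′≤0 (α-even (suc m)) (swap inside) (trans (det-at-even β-solves α-solves (suc m)) det-βα))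
        where
        β′≤0 : β (suc i) ≤ 0ℤ
        β′≤0 = ≮⇒≥ (λ 0<β → outside₁ (α-even (suc m) , 0<β))
        K-coordinates′ : ∀ i → K i ≡ + q₂ * β i + + q₁ * α i
        K-coordinates′ i = trans (K-coordinates i) (+-comm (+ q₁ * α i) (+ q₂ * β i))

      in-quadrant⇒intermediate-pair : ∀ j → InQuadrant α β j →
                                      IntermediatePair a q₂ q₁ ⊎ IntermediatePair a q₁ q₂
      in-quadrant⇒intermediate-pair zero          (_ , 0<β₀) = contradiction 0<β₀ 0≮β₀
      in-quadrant⇒intermediate-pair (suc zero)    (0<α₁ , _) = contradiction 0<α₁ 0≮α₁
      in-quadrant⇒intermediate-pair (suc (suc i)) inside =
        [ in-quadrant⇒intermediate-pair (suc i)
        , (λ outside₁ → [ in-quadrant⇒intermediate-pair i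
                        , (λ outside₀ → entry⇒intermediate-pair i outside₀ outside₁ inside)
                        ]′ (inside? i))
        ]′ (inside? (suc i))

  farey⇒intermediate-pair : ∀ p₁ q₁ p₂ q₂ → IsFiniteFarey p₁ q₁ p₂ q₂ → InInterval a p₁ q₁ p₂ q₂ →
               IntermediatePair a q₂ q₁ ⊎ IntermediatePair a q₁ q₂
  farey⇒intermediate-pair p₁ q₁ p₂ q₂ (farey , 0<q₂) (below , above) =
    enter (below⇒β-pos below) (above⇒α-pos above)
    where
    open FareyCoordinates {p₁} {q₁} {p₂} {q₂} farey
    enter : ∃[ m ] 0ℤ < β (m ℕ.* 2) → ∃[ n ] 0ℤ < α (suc (n ℕ.* 2)) →
            IntermediatePair a q₂ q₁ ⊎ IntermediatePair a q₁ q₂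
    enter (m , 0<β) (n , 0<α) = in-quadrant⇒intermediate-pair α-even (β-odd-pos m 0<β) (m ℕ.* 2) (α-even m , 0<β)
      where
      α-even : ∀ j → 0ℤ < α (j ℕ.* 2)
      α-even = α-even-pos 0<q₂ n 0<α

open Coordinates using (farey⇒intermediate-pair)
open import Data.Nat using (_+_; _*_; _≤_; _<_)
open import Data.Nat.Properties
  using (≤-trans; <⇒≤; +-mono-≤; *-monoˡ-≤; m≤m+n; m≤n+m; m≤n*m; +-comm; +-identityʳ; module ≤-Reasoning)

module _ {N : ℕ} {a : CF} (a-cf : IsCF a) (a≤N : ∀ i → a i ≤ N) where

  k-mono : ∀ n → k a (suc n) ≤ k a (suc (suc n))
  k-mono zero    = z≤n
  k-mono (suc n) = begin
    k₂             ≤⟨ m≤n*m k₂ (a (suc n)) {{ℕ.>-nonZero (a-cf n)}} ⟩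
    a (suc n) * k₂ ≤⟨ m≤m+n _ (k a (suc n)) ⟩
    a (suc n) * k₂ + k a (suc n) ∎
    where
    open ≤-Reasoning
    k₂ : ℕ
    k₂ = k a (suc (suc n))

  k-growth : ∀ n → k a (suc (suc (suc n))) ≤ suc N * k a (suc (suc n))
  k-growth n = begin
    a (suc n) * k₂ + k a (suc n) ≤⟨ +-mono-≤ (*-monoˡ-≤ k₂ (a≤N (suc n))) (k-mono n) ⟩
    N * k₂ + k₂                  ≡⟨ +-comm (N * k₂) k₂ ⟩
    suc N * k₂                   ∎
    where
    open ≤-Reasoning
    k₂ : ℕ
    k₂ = k a (suc (suc n))

  convergent-bound : ∀ i D → 0 < k a (suc i) → 0 < k a i + D * k a (suc i) →
                     k a (suc i) ≤ suc N * (k a i + D * k a (suc i))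
  convergent-bound i (suc D) _ _ =
    ≤-trans (≤-trans (m≤m+n (k a (suc i)) _) (m≤n+m _ (k a i))) (m≤n*m _ (suc N))
  convergent-bound zero          zero () _
  convergent-bound (suc zero)    zero _ ()
  convergent-bound (suc (suc i)) zero _ _ =
    subst (λ q → k a (suc (suc (suc i))) ≤ suc N * q) (sym (+-identityʳ _)) (k-growth i)

  intermediate-bound : ∀ i D → D ≤ N → 0 < k a (suc i) → k a i + D * k a (suc i) ≤ suc N * k a (suc i)
  intermediate-bound zero    D D≤N ()
  intermediate-bound (suc i) D D≤N _ = +-mono-≤ (k-mono i) (*-monoˡ-≤ (k a (suc (suc i))) D≤N)

  intermediate-ratio : ∀ {q q′} → IntermediatePair a q q′ → 0 < q → 0 < q′ →
                       q ≤ suc N * q′ × q′ ≤ suc N * q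
  intermediate-ratio (i , D , D<a , refl , refl) 0<q 0<q′ =
    convergent-bound i D 0<q 0<q′ , intermediate-bound i D (≤-trans (<⇒≤ D<a) (a≤N i)) 0<q

lemma5 : (p₁ q₁ p₂ q₂ : ℕ) → IsFiniteFarey p₁ q₁ p₂ q₂ →
    ∃[ a ] (Aloof 4 a × InInterval a p₁ q₁ p₂ q₂) →
    (q₂ ≤ 5 * q₁) × (q₁ ≤ 5 * q₂)
lemma5 p₁ q₁ p₂ q₂ finite@(farey , 0<q₂) (a , (a-cf , a≤4) , x∈I) =
  [ (λ pair → intermediate-ratio a-cf a≤4 pair 0<q₂ 0<q₁)
  , (λ pair → swap (intermediate-ratio a-cf a≤4 pair 0<q₁ 0<q₂))
  ]′ (farey⇒intermediate-pair a p₁ q₁ p₂ q₂ finite x∈I)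
  where
  0<q₁ : 0 < q₁
  0<q₁ = farey⇒0<q₁ p₁ q₁ p₂ q₂ farey
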